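{- Let $D$ be a standard domino tableau of shape $\lambda/\mu$. Then ${\rm sign}(D)=(-1)^{ev(D)}$.
   Context: Partitions are identified with Young diagrams (cell $(i,j)$: row $i$, column $j$); for $\mu\subseteq\lambda$, $\lambda/\mu$ is the set of cells of $\lambda$ not in $\mu$. A standard Young tableau (SYT) of shape $\lambda/\mu$ with $n$ cells is a bijection $T$ from its cells to $[n]$ with $T(i,j)\le T(i',j')$ whenever $i\le i',j\le j'$. A standard domino tableau (SDT) is an SYT of a shape with $2n$ cells in which, for each $i$, the cells with entries $2i-1,2i$ form a domino (two horizontally or vertically adjacent cells); $ev(D)$ is the number of its vertical dominoes lying in even-numbered columns. Write $(i,j)\lhd(i',j')$ if $i<i'$ or ($i=i'$, $j<j'$). For an SYT $T$ of straight shape, ${\rm sign}(T)=(-1)^{\#\{(a,b):a\lhd b,\,T(a)>T(b)\}}$. For $T_1$ of shape $\nu/\mu$ with $k$ cells and $T_2$ of shape $\lambda/\nu$, $T_1\diamond T_2$ equals $T_1$ on $\nu/\mu$ and $T_2+k$ on $\lambda/\nu$. For $T$ of shape $\lambda/\mu$, ${\rm sign}(T)={\rm sign}(T_0){\rm sign}(T_0\diamond T)$ for any SYT $T_0$ of shape $\mu$ (independent of $T_0$). -}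

module Defs where

open import Data.Nat using (ℕ; zero; suc; _≤_; _≥_; _∸_; _+_; _%_; _≡ᵇ_; _<ᵇ_)
open import Data.Bool using (Bool; true; false; _∧_; _∨_; if_then_else_)
open import Data.Integer using (ℤ; -1ℤ; _*_) renaming (_^_ to _^ℤ_)
open import Data.Product using (_×_; _,_; proj₁; proj₂)
open import Data.Sum using (_⊎_)
open import Data.Unit using (⊤)
open import Data.Empty using (⊥)
open import Data.Fin using (Fin; toℕ)
open import Data.List using (List; []; _∷_; length; lookup; _++_)
open import Data.List.Membership.Propositional using (_∈_)
open import Data.List.Relation.Unary.Unique.Propositional using (Unique)
open import Data.List.Relation.Unary.Linked using (Linked)
open import Relation.Binary.PropositionalEquality using (_≡_)
open import Relation.Nullary using (¬_)

-- A cell (i , j): row i, column j, both 1-indexed.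
Cell : Set
Cell = ℕ × ℕ

IsPartition : List ℕ → Set
IsPartition p = Linked _≥_ p

-- k-th part (0-indexed), 0 beyond the length.
part : List ℕ → ℕ → ℕ
part []       _       = 0
part (x ∷ xs) zero    = x
part (x ∷ xs) (suc k) = part xs k

InDiagram : List ℕ → Cell → Set
InDiagram p (i , j) = (1 ≤ i) × (1 ≤ j) × (j ≤ part p (i ∸ 1))

_⊆ᵖ_ : List ℕ → List ℕ → Set
mu ⊆ᵖ la = ∀ c → InDiagram mu c → InDiagram la c

InSkew : List ℕ → List ℕ → Cell → Set
InSkew la mu c = InDiagram la c × ¬ InDiagram mu c

_≤ᶜ_ : Cell → Cell → Set
(i , j) ≤ᶜ (i' , j') = (i ≤ i') × (j ≤ j')

-- A tableau with n cells is encoded by the list w of length n whose k-th entry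
-- (0-indexed) is the cell T⁻¹(k+1).  IsSYT la mu w: w encodes a standard Young
-- tableau of shape la / mu.
IsSYT : List ℕ → List ℕ → List Cell → Set
IsSYT la mu w =
  Unique w
  × (∀ c → (c ∈ w → InSkew la mu c) × (InSkew la mu c → c ∈ w))
  × (∀ (p q : Fin (length w)) → lookup w p ≤ᶜ lookup w q → toℕ p ≤ toℕ q)

Adjacent : Cell → Cell → Set
Adjacent (i , j) (i' , j') =
  ((i ≡ i') × ((j' ≡ suc j) ⊎ (j ≡ suc j')))
  ⊎ ((j ≡ j') × ((i' ≡ suc i) ⊎ (i ≡ suc i')))

-- Entries 2k-1, 2k form a domino for every k (forces even length).
Dominoes : List Cell → Set
Dominoes []           = ⊤
Dominoes (_ ∷ [])     = ⊥
Dominoes (a ∷ b ∷ ws) = Adjacent a b × Dominoes ws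

IsSDT : List ℕ → List ℕ → List Cell → Set
IsSDT la mu w = IsSYT la mu w × Dominoes w

-- ev(D): number of vertical dominoes lying in even-numbered columns.
ev : List Cell → ℕ
ev []           = 0
ev (_ ∷ [])     = 0
ev ((i , j) ∷ (i' , j') ∷ ws) =
  (if (j ≡ᵇ j') ∧ (j % 2 ≡ᵇ 0) then 1 else 0) + ev ws

_◁ᵇ_ : Cell → Cell → Bool
(i , j) ◁ᵇ (i' , j') = (i <ᵇ i') ∨ ((i ≡ᵇ i') ∧ (j <ᵇ j'))

-- number of y in ys with y ◁ x (such y carry larger entries than x)
countBefore : Cell → List Cell → ℕ
countBefore x []       = 0
countBefore x (y ∷ ys) = (if y ◁ᵇ x then 1 else 0) + countBefore x ys

-- #{(a , b) : a ◁ b , T(a) > T(b)} for the tableau encoded by w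
-- (b appears before a in w).
inversions : List Cell → ℕ
inversions []       = 0
inversions (x ∷ xs) = countBefore x xs + inversions xs

signPow : ℕ → ℤ
signPow k = -1ℤ ^ℤ k

signStraight : List Cell → ℤ
signStraight w = signPow (inversions w)

-- T₁ ⋄ T₂ in the list encoding is concatenation.
_⋄_ : List Cell → List Cell → List Cell
t₁ ⋄ t₂ = t₁ ++ t₂

signSkew : List Cell → List Cell → ℤ
signSkew t₀ t = signStraight t₀ * signStraight (t₀ ⋄ t)

-- Concatenation splits the inversion number as
--   inv (P ++ Q) = inv P + cross P Q + inv Q,
-- so signSkew P Q = (-1)^(cross P Q + inv Q) and signSkew is multiplicative:
--   signSkew P (Q ++ R) = signSkew P Q · signSkew (P ++ Q) R.
-- Hence it suffices to treat a single domino {a, b} added after a prefix P of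
-- a standard filling W = T₀ ⋄ D of the straight shape λ.  For a horizontal
-- domino every earlier cell x satisfies [a ◁ x] = [b ◁ x], so the sign is +1.
-- For a vertical domino a = (i , j), b = (i+1 , j) the two indicators differ
-- exactly for the cells of row i+1 left of column j; these all lie in P, so
-- the sign is (-1)^(j-1), which is -1 precisely when j is even.

module Submission where

open import Defs
open import Data.Nat using (ℕ; zero; suc; _+_; _∸_; _≤_; _<_; z≤n; s≤s; _%_; _≡ᵇ_; _<ᵇ_)
open import Data.Nat.Properties
open import Data.Bool using (Bool; true; false; _∧_; if_then_else_; T)
open import Data.Bool.Properties using (∧-zeroʳ)
open import Data.Integer using (ℤ; -1ℤ; 1ℤ; _*_)
import Data.Integer.Properties as ℤ
open import Data.Product using (_,_; proj₁; proj₂)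
open import Data.Sum using (_⊎_; inj₁; inj₂)
open import Data.Empty using (⊥-elim)
open import Function using (_∘_)
open import Data.Fin using (Fin; toℕ) renaming (zero to fzero; suc to fsuc)
open import Data.List using (List; []; _∷_; length; lookup; _++_)
open import Data.List.Properties using (++-assoc; ++-identityʳ)
open import Data.List.Membership.Propositional using (_∈_)
open import Data.List.Membership.Propositional.Properties using (∈-++⁻; ∈-++⁺ˡ; ∈-++⁺ʳ)
open import Data.List.Relation.Unary.Any as Any using (here; there)
open import Data.List.Relation.Unary.Any.Properties using (lookup-index)
import Data.List.Relation.Unary.All as All
import Data.List.Relation.Unary.All.Properties as All
open import Data.List.Relation.Unary.AllPairs using (AllPairs; []; _∷_)
import Data.List.Relation.Unary.AllPairs.Properties as AllPairs
open import Data.List.Relation.Unary.Unique.Propositional using (Unique)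
import Data.List.Relation.Unary.Unique.Propositional.Properties as Unique
import Data.List.Relation.Unary.Linked as Linked
open Linked using (_∷_)
open import Level using (0ℓ)
open import Relation.Binary.Core using (Rel)
open import Relation.Binary.Definitions using (tri<; tri≈; tri>)
open import Relation.Binary.PropositionalEquality
open import Relation.Nullary using (¬_; yes; no; Dec)
open import Relation.Nullary.Decidable using (_×-dec_)
open import Data.Nat.Solver using (module +-*-Solver)
open +-*-Solver using (solve; _:+_; _:=_)

⟦_⟧ : Bool → ℕ
⟦ b ⟧ = if b then 1 else 0

signPow-+ : ∀ m n → signPow (m + n) ≡ signPow m * signPow n
signPow-+ = ℤ.^-distribˡ-+-* -1ℤ

signPow-±1 : ∀ k → signPow k ≡ 1ℤ ⊎ signPow k ≡ -1ℤ
signPow-±1 zero = inj₁ refl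
signPow-±1 (suc k) with signPow-±1 k
... | inj₁ e = inj₂ (cong (-1ℤ *_) e)
... | inj₂ e = inj₁ (cong (-1ℤ *_) e)

signPow-square : ∀ k → signPow k * signPow k ≡ 1ℤ
signPow-square k with signPow-±1 k
... | inj₁ e rewrite e = refl
... | inj₂ e rewrite e = refl

signPow-even : ∀ n m → signPow (n + (m + m)) ≡ signPow n
signPow-even n m = begin
  signPow (n + (m + m))             ≡⟨ signPow-+ n (m + m) ⟩
  signPow n * signPow (m + m)       ≡⟨ cong (signPow n *_) (signPow-+ m m) ⟩
  signPow n * (signPow m * signPow m) ≡⟨ cong (signPow n *_) (signPow-square m) ⟩
  signPow n * 1ℤ                    ≡⟨ ℤ.*-identityʳ (signPow n) ⟩
  signPow n                         ∎
  where open ≡-Reasoning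

signPow-2+ : ∀ k → signPow (suc (suc k)) ≡ signPow k
signPow-2+ k = trans (sym (ℤ.*-assoc -1ℤ -1ℤ (signPow k))) (ℤ.*-identityˡ (signPow k))

signPow-column : ∀ j → 1 ≤ j → signPow (j ∸ 1) ≡ signPow ⟦ j % 2 ≡ᵇ 0 ⟧
signPow-column (suc zero) _ = refl
signPow-column (suc (suc zero)) _ = refl
signPow-column (suc (suc (suc k))) _ = trans (signPow-2+ k) (signPow-column (suc k) (s≤s z≤n))

sumOver : {A : Set} → (A → ℕ) → List A → ℕ
sumOver f []       = 0
sumOver f (x ∷ xs) = f x + sumOver f xs

sumOver-cong : {A : Set} {f g : A → ℕ} (xs : List A)
             → (∀ {x} → x ∈ xs → f x ≡ g x) → sumOver f xs ≡ sumOver g xs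
sumOver-cong []       eq = refl
sumOver-cong (x ∷ xs) eq = cong₂ _+_ (eq (here refl)) (sumOver-cong xs (eq ∘ there))

sumOver-zero : {A : Set} {f : A → ℕ} (xs : List A)
             → (∀ {x} → x ∈ xs → f x ≡ 0) → sumOver f xs ≡ 0
sumOver-zero []       eq = refl
sumOver-zero (x ∷ xs) eq rewrite eq (here refl) = sumOver-zero xs (λ m → eq (there m))

private
  interchange : ∀ a b c d → (a + b) + (c + d) ≡ (a + c) + (b + d)
  interchange = solve 4 (λ a b c d → (a :+ b) :+ (c :+ d) := (a :+ c) :+ (b :+ d)) refl

sumOver-+ : {A : Set} (f g : A → ℕ) (xs : List A)
          → sumOver (λ x → f x + g x) xs ≡ sumOver f xs + sumOver g xs
sumOver-+ f g []       = refl
sumOver-+ f g (x ∷ xs) rewrite sumOver-+ f g xs =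
  interchange (f x) (g x) (sumOver f xs) (sumOver g xs)

cross : List Cell → List Cell → ℕ
cross P Q = sumOver (λ x → countBefore x Q) P

countBefore-++ : ∀ x P Q → countBefore x (P ++ Q) ≡ countBefore x P + countBefore x Q
countBefore-++ x []      Q = refl
countBefore-++ x (y ∷ P) Q rewrite countBefore-++ x P Q =
  sym (+-assoc ⟦ y ◁ᵇ x ⟧ (countBefore x P) (countBefore x Q))

private
  regroup : ∀ a b c d e → (a + b) + (c + (d + e)) ≡ (a + c) + ((b + d) + e)
  regroup = solve 5 (λ a b c d e → (a :+ b) :+ (c :+ (d :+ e)) := (a :+ c) :+ ((b :+ d) :+ e)) refl

inversions-++ : ∀ P Q → inversions (P ++ Q) ≡ inversions P + (cross P Q + inversions Q)
inversions-++ []      Q = refl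
inversions-++ (x ∷ P) Q rewrite countBefore-++ x P Q | inversions-++ P Q =
  regroup (countBefore x P) (countBefore x Q) (inversions P) (cross P Q) (inversions Q)

signSkew-exponent : ∀ P Q → signSkew P Q ≡ signPow (cross P Q + inversions Q)
signSkew-exponent P Q = begin
  s * signPow (inversions (P ++ Q))          ≡⟨ cong (λ k → s * signPow k) (inversions-++ P Q) ⟩
  s * signPow (inversions P + e)              ≡⟨ cong (s *_) (signPow-+ (inversions P) e) ⟩
  s * (s * signPow e)                         ≡⟨ sym (ℤ.*-assoc s s (signPow e)) ⟩
  (s * s) * signPow e                         ≡⟨ cong (_* signPow e) (signPow-square (inversions P)) ⟩
  1ℤ * signPow e                              ≡⟨ ℤ.*-identityˡ (signPow e) ⟩
  signPow e                                   ∎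
  where
  open ≡-Reasoning
  s : ℤ
  s = signPow (inversions P)
  e : ℕ
  e = cross P Q + inversions Q

signSkew-[] : ∀ P → signSkew P [] ≡ 1ℤ
signSkew-[] P rewrite ++-identityʳ P = signPow-square (inversions P)

signSkew-++ : ∀ P Q R → signSkew P (Q ++ R) ≡ signSkew P Q * signSkew (P ++ Q) R
signSkew-++ P Q R = begin
  s * signStraight (P ++ (Q ++ R))    ≡⟨ cong (λ W → s * signStraight W) (sym (++-assoc P Q R)) ⟩
  s * t                               ≡⟨ cong (s *_) (sym (ℤ.*-identityˡ t)) ⟩
  s * (1ℤ * t)                        ≡⟨ cong (λ z → s * (z * t)) (sym (signPow-square (inversions (P ++ Q)))) ⟩
  s * ((s' * s') * t)                 ≡⟨ cong (s *_) (ℤ.*-assoc s' s' t) ⟩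
  s * (s' * (s' * t))                 ≡⟨ sym (ℤ.*-assoc s s' (s' * t)) ⟩
  (s * s') * (s' * t)                 ∎
  where
  open ≡-Reasoning
  s s' t : ℤ
  s  = signStraight P
  s' = signStraight (P ++ Q)
  t  = signStraight ((P ++ Q) ++ R)

T⇒≡true : ∀ {b} → T b → b ≡ true
T⇒≡true {true} _ = refl

¬T⇒≡false : ∀ {b} → ¬ T b → b ≡ false
¬T⇒≡false {false} _ = refl
¬T⇒≡false {true}  h = ⊥-elim (h _)

<ᵇ-true : ∀ {m n} → m < n → (m <ᵇ n) ≡ true
<ᵇ-true m<n = T⇒≡true (<⇒<ᵇ m<n)

<ᵇ-false : ∀ {m n} → n ≤ m → (m <ᵇ n) ≡ false
<ᵇ-false {m} {n} n≤m = ¬T⇒≡false (λ t → <⇒≱ (<ᵇ⇒< m n t) n≤m)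

≡ᵇ-refl : ∀ m → (m ≡ᵇ m) ≡ true
≡ᵇ-refl m = T⇒≡true (≡⇒≡ᵇ m m refl)

≡ᵇ-false : ∀ {m n} → m ≢ n → (m ≡ᵇ n) ≡ false
≡ᵇ-false {m} {n} m≢n = ¬T⇒≡false (m≢n ∘ ≡ᵇ⇒≡ m n)

<ᵇ-shift : ∀ j c → c ≢ suc j → (j <ᵇ c) ≡ (suc j <ᵇ c)
<ᵇ-shift j       zero          _  = refl
<ᵇ-shift zero    (suc zero)    ne = ⊥-elim (ne refl)
<ᵇ-shift zero    (suc (suc c)) _  = refl
<ᵇ-shift (suc j) (suc c)       ne = <ᵇ-shift j c (ne ∘ cong suc)

◁ᵇ-lower-row : ∀ {i r} j c → i < r → ((i , j) ◁ᵇ (r , c)) ≡ true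
◁ᵇ-lower-row j c i<r rewrite <ᵇ-true i<r = refl

◁ᵇ-higher-row : ∀ {i r} j c → r < i → ((i , j) ◁ᵇ (r , c)) ≡ false
◁ᵇ-higher-row j c r<i rewrite <ᵇ-false (<⇒≤ r<i) | ≡ᵇ-false (>⇒≢ r<i) = refl

◁ᵇ-same-row : ∀ i j c → ((i , j) ◁ᵇ (i , c)) ≡ (j <ᵇ c)
◁ᵇ-same-row i j c rewrite <ᵇ-false (≤-refl {i}) | ≡ᵇ-refl i = refl

◁ᵇ-horizontal : ∀ i j x → x ≢ (i , suc j) → ((i , j) ◁ᵇ x) ≡ ((i , suc j) ◁ᵇ x)
◁ᵇ-horizontal i j (r , c) ne with <-cmp i r
... | tri< i<r _ _ rewrite ◁ᵇ-lower-row j c i<r | ◁ᵇ-lower-row (suc j) c i<r = refl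
... | tri> _ _ r<i rewrite ◁ᵇ-higher-row j c r<i | ◁ᵇ-higher-row (suc j) c r<i = refl
... | tri≈ _ refl _ rewrite ◁ᵇ-same-row i j c | ◁ᵇ-same-row i (suc j) c =
  <ᵇ-shift j c (ne ∘ cong (i ,_))

leftInRow : ℕ → ℕ → Cell → Bool
leftInRow r j (r' , c) = (r' ≡ᵇ r) ∧ (c <ᵇ j)

◁ᵇ-vertical : ∀ i j x → x ≢ (suc i , j) → ¬ ((i , j) ≤ᶜ x)
            → ⟦ (i , j) ◁ᵇ x ⟧ + ⟦ (suc i , j) ◁ᵇ x ⟧
              ≡ ⟦ leftInRow (suc i) j x ⟧ + (⟦ (suc i , j) ◁ᵇ x ⟧ + ⟦ (suc i , j) ◁ᵇ x ⟧)
◁ᵇ-vertical i j (r , c) ne not-se with <-cmp r i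
... | tri< r<i _ _
  rewrite ◁ᵇ-higher-row j c r<i | ◁ᵇ-higher-row j c (m<n⇒m<1+n r<i)
        | ≡ᵇ-false (<⇒≢ (m<n⇒m<1+n r<i)) = refl
... | tri≈ _ refl _
  rewrite ◁ᵇ-higher-row j c (n<1+n r) | ◁ᵇ-same-row r j c
        | <ᵇ-false (<⇒≤ (≰⇒> (not-se ∘ (≤-refl ,_)))) | ≡ᵇ-false (<⇒≢ (n<1+n r)) = refl
... | tri> _ _ i<r with <-cmp r (suc i)
...   | tri< r<1+i _ _ = ⊥-elim (<⇒≱ i<r (≤-pred r<1+i))
...   | tri> _ _ 1+i<r
  rewrite ◁ᵇ-lower-row j c i<r | ◁ᵇ-lower-row j c 1+i<r | ≡ᵇ-false (>⇒≢ 1+i<r) = refl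
...   | tri≈ _ refl _ rewrite ◁ᵇ-lower-row j c i<r | ◁ᵇ-same-row (suc i) j c | ≡ᵇ-refl (suc i)
  with <-cmp c j
...     | tri< c<j _ _ rewrite <ᵇ-true c<j | <ᵇ-false (<⇒≤ c<j) = refl
...     | tri≈ _ refl _ = ⊥-elim (ne refl)
...     | tri> _ _ j<c rewrite <ᵇ-true j<c | <ᵇ-false (<⇒≤ j<c) = refl

rowCount : ℕ → ℕ → List Cell → ℕ
rowCount r j = sumOver (⟦_⟧ ∘ leftInRow r j)

isCell : Cell → Cell → Bool
isCell (r , n) (r' , c) = (r' ≡ᵇ r) ∧ (c ≡ᵇ n)

isCell-refl : ∀ y → isCell y y ≡ true
isCell-refl (r , n) rewrite ≡ᵇ-refl r | ≡ᵇ-refl n = refl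

isCell-distinct : ∀ y x → x ≢ y → isCell y x ≡ false
isCell-distinct (r , n) (r' , c) x≢y with r' ≟ r
... | no r'≢r rewrite ≡ᵇ-false r'≢r = refl
... | yes refl rewrite ≡ᵇ-refl r' = ≡ᵇ-false (x≢y ∘ cong (r' ,_))

isCell-count : ∀ y L → Unique L → y ∈ L → sumOver (⟦_⟧ ∘ isCell y) L ≡ 1
isCell-count y (x ∷ L) (x∉L ∷ u) (here refl) rewrite isCell-refl y =
  cong suc (sumOver-zero L (λ m → cong ⟦_⟧ (isCell-distinct y _ (≢-sym (All.lookup x∉L m)))))
isCell-count y (x ∷ L) (x∉L ∷ u) (there y∈L)
  rewrite isCell-distinct y x (All.lookup x∉L y∈L) = isCell-count y L u y∈L

leftInRow-suc : ∀ r n x → ⟦ leftInRow r (suc n) x ⟧ ≡ ⟦ leftInRow r n x ⟧ + ⟦ isCell (r , n) x ⟧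
leftInRow-suc r n (r' , c) with r' ≡ᵇ r
... | false = refl
... | true  = column c n
  where
  column : ∀ c n → ⟦ c <ᵇ suc n ⟧ ≡ ⟦ c <ᵇ n ⟧ + ⟦ c ≡ᵇ n ⟧
  column zero    zero    = refl
  column zero    (suc n) = refl
  column (suc c) zero    = refl
  column (suc c) (suc n) = column c n

rowCount-full : ∀ r j L → Unique L → (∀ {x} → x ∈ L → 1 ≤ proj₂ x)
              → (∀ c → 1 ≤ c → c ≤ j → (r , c) ∈ L) → rowCount r (suc j) L ≡ j
rowCount-full r zero L _ positive _ =
  sumOver-zero L (λ { {r' , c} m → cong ⟦_⟧ (trans (cong ((r' ≡ᵇ r) ∧_) (<ᵇ-false (positive m)))
                                                    (∧-zeroʳ (r' ≡ᵇ r))) })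
rowCount-full r (suc j) L u positive full = begin
  rowCount r (suc (suc j)) L
    ≡⟨ sumOver-cong L (λ {x} _ → leftInRow-suc r (suc j) x) ⟩
  sumOver (λ x → ⟦ leftInRow r (suc j) x ⟧ + ⟦ isCell (r , suc j) x ⟧) L
    ≡⟨ sumOver-+ (⟦_⟧ ∘ leftInRow r (suc j)) (⟦_⟧ ∘ isCell (r , suc j)) L ⟩
  rowCount r (suc j) L + sumOver (⟦_⟧ ∘ isCell (r , suc j)) L
    ≡⟨ cong₂ _+_ (rowCount-full r j L u positive (λ c 1≤c c≤j → full c 1≤c (m≤n⇒m≤1+n c≤j)))
                 (isCell-count (r , suc j) L u (full (suc j) (s≤s z≤n) ≤-refl)) ⟩
  j + 1
    ≡⟨ +-comm j 1 ⟩
  suc j ∎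
  where open ≡-Reasoning

module _ {A : Set} {R : Rel A 0ℓ} where

  allPairs-left : ∀ P {Q} → AllPairs R (P ++ Q) → AllPairs R P
  allPairs-left []      _          = []
  allPairs-left (x ∷ P) (px ∷ pxs) = All.++⁻ˡ P px ∷ allPairs-left P pxs

  allPairs-right : ∀ P {Q} → AllPairs R (P ++ Q) → AllPairs R Q
  allPairs-right []      pxs       = pxs
  allPairs-right (x ∷ P) (_ ∷ pxs) = allPairs-right P pxs

  allPairs-across : ∀ P {Q x y} → AllPairs R (P ++ Q) → x ∈ P → y ∈ Q → R x y
  allPairs-across (z ∷ P) (pz ∷ _)   (here refl) y∈Q = All.lookup pz (∈-++⁺ʳ P y∈Q)
  allPairs-across (z ∷ P) (_ ∷ pxs) (there x∈P) y∈Q = allPairs-across P pxs x∈P y∈Q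

Before : Cell → Cell → Set
Before x y = ¬ (y ≤ᶜ x)

record StandardFilling (la : List ℕ) (W : List Cell) : Set where
  field
    distinct : Unique W
    ordered  : AllPairs Before W
    sound    : ∀ {c} → c ∈ W → InDiagram la c
    complete : ∀ {c} → InDiagram la c → c ∈ W

verticalEven : Cell → Cell → Bool
verticalEven (_ , j) (_ , j') = (j ≡ᵇ j') ∧ (j % 2 ≡ᵇ 0)

readBefore : Cell → Cell → ℕ
readBefore y x = ⟦ y ◁ᵇ x ⟧

cross-horizontal : ∀ P i j → (∀ {x} → x ∈ P → x ≢ (i , suc j))
  → cross P ((i , j) ∷ (i , suc j) ∷ [])
    ≡ 0 + (sumOver (readBefore (i , suc j)) P + sumOver (readBefore (i , suc j)) P)
cross-horizontal P i j b∉P = trans (sumOver-cong P paired) (sumOver-+ h h P)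
  where
  h : Cell → ℕ
  h = readBefore (i , suc j)
  paired : ∀ {x} → x ∈ P → readBefore (i , j) x + (h x + 0) ≡ h x + h x
  paired {x} x∈P rewrite +-identityʳ (h x) = cong (λ t → ⟦ t ⟧ + h x) (◁ᵇ-horizontal i j x (b∉P x∈P))

cross-vertical : ∀ P i j → (∀ {x} → x ∈ P → x ≢ (suc i , j)) → (∀ {x} → x ∈ P → ¬ ((i , j) ≤ᶜ x))
  → cross P ((i , j) ∷ (suc i , j) ∷ [])
    ≡ rowCount (suc i) j P + (sumOver (readBefore (suc i , j)) P + sumOver (readBefore (suc i , j)) P)
cross-vertical P i j b∉P not-se = begin
  cross P ((i , j) ∷ (suc i , j) ∷ [])
    ≡⟨ sumOver-cong P (λ {x} x∈P → trans (cong (readBefore (i , j) x +_) (+-identityʳ (h x)))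
                                          (◁ᵇ-vertical i j x (b∉P x∈P) (not-se x∈P))) ⟩
  sumOver (λ x → ⟦ leftInRow (suc i) j x ⟧ + (h x + h x)) P
    ≡⟨ sumOver-+ (⟦_⟧ ∘ leftInRow (suc i) j) (λ x → h x + h x) P ⟩
  rowCount (suc i) j P + sumOver (λ x → h x + h x) P
    ≡⟨ cong (rowCount (suc i) j P +_) (sumOver-+ h h P) ⟩
  rowCount (suc i) j P + (sumOver h P + sumOver h P) ∎
  where
  open ≡-Reasoning
  h : Cell → ℕ
  h = readBefore (suc i , j)

signSkew-pair : ∀ P a b → signSkew P (a ∷ b ∷ []) ≡ signPow (cross P (a ∷ b ∷ []) + readBefore b a)
signSkew-pair P a b = trans (signSkew-exponent P (a ∷ b ∷ [])) (cong (λ k → signPow (cross P (a ∷ b ∷ []) + k)) pair)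
  where
  pair : inversions (a ∷ b ∷ []) ≡ readBefore b a
  pair = trans (+-identityʳ (readBefore b a + 0)) (+-identityʳ (readBefore b a))

horizontal-domino : ∀ P i j → (∀ {x} → x ∈ P → x ≢ (i , suc j))
  → signSkew P ((i , j) ∷ (i , suc j) ∷ []) ≡ signPow ⟦ verticalEven (i , j) (i , suc j) ⟧
horizontal-domino P i j b∉P = begin
  signSkew P ((i , j) ∷ (i , suc j) ∷ [])
    ≡⟨ signSkew-pair P (i , j) (i , suc j) ⟩
  signPow (cross P ((i , j) ∷ (i , suc j) ∷ []) + readBefore (i , suc j) (i , j))
    ≡⟨ cong₂ (λ m n → signPow (m + n)) (cross-horizontal P i j b∉P) b-after-a ⟩
  signPow ((0 + (sumOver h P + sumOver h P)) + 0)
    ≡⟨ cong signPow (+-identityʳ (sumOver h P + sumOver h P)) ⟩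
  signPow (0 + (sumOver h P + sumOver h P))
    ≡⟨ signPow-even 0 (sumOver h P) ⟩
  signPow 0
    ≡⟨ cong (λ t → signPow ⟦ t ∧ (j % 2 ≡ᵇ 0) ⟧) (sym (≡ᵇ-false (<⇒≢ (n<1+n j)))) ⟩
  signPow ⟦ verticalEven (i , j) (i , suc j) ⟧ ∎
  where
  open ≡-Reasoning
  h : Cell → ℕ
  h = readBefore (i , suc j)
  b-after-a : readBefore (i , suc j) (i , j) ≡ 0
  b-after-a = cong ⟦_⟧ (trans (◁ᵇ-same-row i (suc j) j) (<ᵇ-false (n≤1+n j)))

vertical-domino : ∀ P i j → Unique P → (∀ {x} → x ∈ P → 1 ≤ proj₂ x)
  → (∀ {x} → x ∈ P → x ≢ (suc i , j)) → (∀ {x} → x ∈ P → ¬ ((i , j) ≤ᶜ x))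
  → (∀ c → 1 ≤ c → c < j → (suc i , c) ∈ P) → 1 ≤ j
  → signSkew P ((i , j) ∷ (suc i , j) ∷ []) ≡ signPow ⟦ verticalEven (i , j) (suc i , j) ⟧
vertical-domino P i (suc j) u positive b∉P not-se row-placed 1≤j = begin
  signSkew P (a ∷ b ∷ [])
    ≡⟨ signSkew-pair P a b ⟩
  signPow (cross P (a ∷ b ∷ []) + readBefore b a)
    ≡⟨ cong₂ (λ m n → signPow (m + n)) (cross-vertical P i (suc j) b∉P not-se) b-after-a ⟩
  signPow ((rowCount (suc i) (suc j) P + (sumOver h P + sumOver h P)) + 0)
    ≡⟨ cong signPow (+-identityʳ (rowCount (suc i) (suc j) P + (sumOver h P + sumOver h P))) ⟩
  signPow (rowCount (suc i) (suc j) P + (sumOver h P + sumOver h P))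
    ≡⟨ signPow-even (rowCount (suc i) (suc j) P) (sumOver h P) ⟩
  signPow (rowCount (suc i) (suc j) P)
    ≡⟨ cong signPow (rowCount-full (suc i) j P u positive (λ c 1≤c c≤j → row-placed c 1≤c (s≤s c≤j))) ⟩
  signPow (suc j ∸ 1)
    ≡⟨ signPow-column (suc j) 1≤j ⟩
  signPow ⟦ suc j % 2 ≡ᵇ 0 ⟧
    ≡⟨ cong (λ t → signPow ⟦ t ∧ (suc j % 2 ≡ᵇ 0) ⟧) (sym (≡ᵇ-refl (suc j))) ⟩
  signPow ⟦ verticalEven a b ⟧ ∎
  where
  open ≡-Reasoning
  a b : Cell
  a = (i , suc j)
  b = (suc i , suc j)
  h : Cell → ℕ
  h = readBefore b
  b-after-a : readBefore b a ≡ 0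
  b-after-a = cong ⟦_⟧ (◁ᵇ-higher-row (suc j) (suc j) (n<1+n i))

signSkew-domino : ∀ {la} P a b D → StandardFilling la (P ++ a ∷ b ∷ D) → Adjacent a b
  → signSkew P (a ∷ b ∷ []) ≡ signPow ⟦ verticalEven a b ⟧
signSkew-domino P (i , j) (i' , j') D F adjacent = by-shape adjacent
  where
  open StandardFilling F
  a-before-b : Before (i , j) (i' , j')
  a-before-b with allPairs-right P ordered
  ... | a-before ∷ _ = All.head a-before
  b-before-D : All.All (Before (i' , j')) D
  b-before-D with allPairs-right P ordered
  ... | _ ∷ b-before ∷ _ = b-before
  b∉P : ∀ {x} → x ∈ P → x ≢ (i' , j')
  b∉P x∈P = allPairs-across P distinct x∈P (there (here refl))
  by-shape : Adjacent (i , j) (i' , j') → signSkew P ((i , j) ∷ (i' , j') ∷ []) ≡ signPow ⟦ verticalEven (i , j) (i' , j') ⟧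
  by-shape (inj₁ (refl , inj₁ refl)) = horizontal-domino P i j b∉P
  by-shape (inj₁ (refl , inj₂ refl)) = ⊥-elim (a-before-b (≤-refl , n≤1+n j'))
  by-shape (inj₂ (refl , inj₂ refl)) = ⊥-elim (a-before-b (n≤1+n i' , ≤-refl))
  by-shape (inj₂ (refl , inj₁ refl)) =
    vertical-domino P i j (allPairs-left P distinct) (positive ∘ ∈-++⁺ˡ) b∉P
      (λ x∈P → allPairs-across P ordered x∈P (here refl)) row-placed (positive (∈-++⁺ʳ P (here refl)))
    where
    positive : ∀ {x} → x ∈ P ++ (i , j) ∷ (suc i , j) ∷ D → 1 ≤ proj₂ x
    positive = proj₁ ∘ proj₂ ∘ sound
    -- (suc i , c) lies in the diagram, so it is a cell of the filling;
    -- it is neither a nor b, and cannot follow b since it is left of b.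
    row-placed : ∀ c → 1 ≤ c → c < j → (suc i , c) ∈ P
    row-placed c 1≤c c<j with sound (∈-++⁺ʳ P (there (here refl)))
    ... | (1≤r , _ , j≤part) with ∈-++⁻ P (complete (1≤r , 1≤c , ≤-trans (<⇒≤ c<j) j≤part))
    ...   | inj₁ in-P = in-P
    ...   | inj₂ (here e) = ⊥-elim (1+n≢n (cong proj₁ e))
    ...   | inj₂ (there (here e)) = ⊥-elim (<-irrefl (cong proj₂ e) c<j)
    ...   | inj₂ (there (there in-D)) = ⊥-elim (All.lookup b-before-D in-D (≤-refl , <⇒≤ c<j))

signSkew-dominoes : ∀ {la} P D → StandardFilling la (P ++ D) → Dominoes D → signSkew P D ≡ signPow (ev D)
signSkew-dominoes P [] _ _ = signSkew-[] P
signSkew-dominoes {la} P (a ∷ b ∷ D) F (adjacent , dominoes) = begin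
  signSkew P (a ∷ b ∷ D)
    ≡⟨ signSkew-++ P (a ∷ b ∷ []) D ⟩
  signSkew P (a ∷ b ∷ []) * signSkew (P ++ a ∷ b ∷ []) D
    ≡⟨ cong₂ _*_ (signSkew-domino P a b D F adjacent)
                 (signSkew-dominoes (P ++ a ∷ b ∷ []) D F′ dominoes) ⟩
  signPow ⟦ verticalEven a b ⟧ * signPow (ev D)
    ≡⟨ sym (signPow-+ ⟦ verticalEven a b ⟧ (ev D)) ⟩
  signPow (ev (a ∷ b ∷ D)) ∎
  where
  open ≡-Reasoning
  F′ : StandardFilling la ((P ++ a ∷ b ∷ []) ++ D)
  F′ = subst (StandardFilling la) (sym (++-assoc P (a ∷ b ∷ []) D)) F

ordered-from-lookup : {A : Set} {R : Rel A 0ℓ} (w : List A)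
  → (∀ (p q : Fin (length w)) → R (lookup w p) (lookup w q) → toℕ p ≤ toℕ q)
  → AllPairs (λ x y → ¬ R y x) w
ordered-from-lookup []      _ = []
ordered-from-lookup {R = R} (y ∷ w) monotone =
  All.tabulate (λ x∈w Rxy → n≮0 (monotone (fsuc (Any.index x∈w)) fzero (subst (λ z → R z y) (lookup-index x∈w) Rxy)))
  ∷ ordered-from-lookup w (λ p q → ≤-pred ∘ monotone (fsuc p) (fsuc q))

part-antitone : ∀ {p} → IsPartition p → ∀ {m n} → m ≤ n → part p n ≤ part p m
part-antitone {[]}    _ _ = z≤n
part-antitone {x ∷ p} linked {zero} {n} _ = first-largest linked n
  where
  first-largest : ∀ {x p} → IsPartition (x ∷ p) → ∀ k → part (x ∷ p) k ≤ x
  first-largest _ zero = ≤-refl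
  first-largest {p = []}    _ (suc k) = z≤n
  first-largest {p = y ∷ p} (x≥y ∷ linked) (suc k) = ≤-trans (first-largest linked k) x≥y
part-antitone {x ∷ p} linked {suc m} {suc n} m≤n = part-antitone (Linked.tail linked) (≤-pred m≤n)

diagram-closed : ∀ {p} → IsPartition p → ∀ {x y} → InDiagram p x → y ≤ᶜ x
  → 1 ≤ proj₁ y → 1 ≤ proj₂ y → InDiagram p y
diagram-closed partition {i , j} {i' , j'} (_ , _ , j≤part) (i'≤i , j'≤j) 1≤i' 1≤j' =
  1≤i' , 1≤j' , ≤-trans j'≤j (≤-trans j≤part (part-antitone partition (∸-monoˡ-≤ 1 i'≤i)))

inDiagram? : ∀ p c → Dec (InDiagram p c)
inDiagram? p (i , j) = (1 ≤? i) ×-dec ((1 ≤? j) ×-dec (j ≤? part p (i ∸ 1)))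

-- T₀ ⋄ D is a standard filling of la: the cells of mu are listed first,
-- and no cell of la / mu lies weakly north-west of a cell of mu.
concat-filling : ∀ {la mu T₀ D} → IsPartition mu → mu ⊆ᵖ la
  → IsSYT mu [] T₀ → IsSYT la mu D → StandardFilling la (T₀ ⋄ D)
concat-filling {la} {mu} {T₀} {D} partition mu⊆la (uT , memT , ordT) (uD , memD , ordD) = record
  { distinct = Unique.++⁺ uT uD (λ (x∈T , x∈D) → proj₂ (in-skew x∈D) (proj₁ (in-mu x∈T)))
  ; ordered  = AllPairs.++⁺ (ordered-from-lookup T₀ ordT) (ordered-from-lookup D ordD)
                 (All.tabulate (λ x∈T → All.tabulate (λ y∈D → mu-before-skew x∈T y∈D)))
  ; sound    = sound
  ; complete = complete
  }
  where
  in-mu : ∀ {c} → c ∈ T₀ → InSkew mu [] c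
  in-mu = proj₁ (memT _)
  in-skew : ∀ {c} → c ∈ D → InSkew la mu c
  in-skew = proj₁ (memD _)
  mu-before-skew : ∀ {x y} → x ∈ T₀ → y ∈ D → Before x y
  mu-before-skew x∈T y∈D y≤x with in-skew y∈D
  ... | (1≤i , 1≤j , _) , y∉mu = y∉mu (diagram-closed partition (proj₁ (in-mu x∈T)) y≤x 1≤i 1≤j)
  sound : ∀ {c} → c ∈ T₀ ⋄ D → InDiagram la c
  sound {c} c∈W with ∈-++⁻ T₀ c∈W
  ... | inj₁ c∈T = mu⊆la c (proj₁ (in-mu c∈T))
  ... | inj₂ c∈D = proj₁ (in-skew c∈D)
  complete : ∀ {c} → InDiagram la c → c ∈ T₀ ⋄ D
  complete {c} c∈la with inDiagram? mu c
  ... | yes c∈mu = ∈-++⁺ˡ (proj₂ (memT c) (c∈mu , λ { (_ , 1≤j , j≤0) → <⇒≱ 1≤j j≤0 }))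
  ... | no  c∉mu = ∈-++⁺ʳ T₀ (proj₂ (memD c) (c∈la , c∉mu))

proposition4p3 : (la mu : List ℕ) → IsPartition la → IsPartition mu → mu ⊆ᵖ la
    → (D : List Cell) → IsSDT la mu D
    → (T₀ : List Cell) → IsSYT mu [] T₀
    → signSkew T₀ D ≡ signPow (ev D)
proposition4p3 la mu _ mu-partition mu⊆la D (syt , dominoes) T₀ syt₀ =
  signSkew-dominoes T₀ D (concat-filling {la} mu-partition mu⊆la syt₀ syt) dominoes
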